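{- Let $L$ be a residuated lattice and $n\geq 1$ an integer. Every $n$-fold fantastic filter of $L$ is an $n$-fold normal filter of $L$.
   Context: A residuated lattice is an algebra $(L,\wedge,\vee,\otimes,\rightarrow,0,1)$ such that $(L,\wedge,\vee,0,1)$ is a bounded lattice, $(L,\otimes,1)$ is a commutative monoid, and $x\otimes y\leq z$ iff $x\leq y\rightarrow z$. A filter of $L$ is a nonempty subset closed under $\otimes$ and upward closed. For $x\in L$, $x^n=x\otimes\cdots\otimes x$ ($n$ factors). A subset $F\subseteq L$ is an $n$-fold fantastic filter if $1\in F$ and for all $x,y\in L$: $y\rightarrow x\in F$ implies $((x^n\rightarrow y)\rightarrow y)\rightarrow x\in F$. A filter $F$ of $L$ is an $n$-fold normal filter if for all $x,y\in L$: $(y^n\rightarrow x)\rightarrow x\in F$ implies $(x\rightarrow y)\rightarrow y\in F$. -}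

module Defs where

open import Level using (Level; suc; _⊔_)
open import Data.Nat using (ℕ; zero) renaming (suc to sucℕ)
open import Data.Product using (_×_; ∃)
open import Relation.Binary.PropositionalEquality using (_≡_)

record ResiduatedLattice (c : Level) : Set (suc c) where
  infixr 5 _⇒_
  infixl 7 _⊗_
  infixr 6 _∧_
  infixr 6 _∨_
  field
    Carrier : Set c
    _∧_ _∨_ _⊗_ _⇒_ : Carrier → Carrier → Carrier
    𝟎 𝟏 : Carrier
    ∧-comm   : ∀ x y → x ∧ y ≡ y ∧ x
    ∧-assoc  : ∀ x y z → (x ∧ y) ∧ z ≡ x ∧ (y ∧ z)
    ∨-comm   : ∀ x y → x ∨ y ≡ y ∨ x
    ∨-assoc  : ∀ x y z → (x ∨ y) ∨ z ≡ x ∨ (y ∨ z)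
    ∧-absorb-∨ : ∀ x y → x ∧ (x ∨ y) ≡ x
    ∨-absorb-∧ : ∀ x y → x ∨ (x ∧ y) ≡ x
    𝟎-bot    : ∀ x → 𝟎 ∧ x ≡ 𝟎
    𝟏-top    : ∀ x → x ∧ 𝟏 ≡ x
    ⊗-comm   : ∀ x y → x ⊗ y ≡ y ⊗ x
    ⊗-assoc  : ∀ x y z → (x ⊗ y) ⊗ z ≡ x ⊗ (y ⊗ z)
    ⊗-identityʳ : ∀ x → x ⊗ 𝟏 ≡ x

  infix 4 _≤_
  _≤_ : Carrier → Carrier → Set c
  x ≤ y = x ∧ y ≡ x

  field
    residuation-⇒ : ∀ x y z → x ⊗ y ≤ z → x ≤ y ⇒ z
    residuation-⇐ : ∀ x y z → x ≤ y ⇒ z → x ⊗ y ≤ z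

  _^_ : Carrier → ℕ → Carrier
  x ^ zero = 𝟏
  x ^ sucℕ n = x ⊗ (x ^ n)

module _ {c : Level} (L : ResiduatedLattice c) where
  open ResiduatedLattice L

  Subset : (ℓ : Level) → Set (c ⊔ suc ℓ)
  Subset ℓ = Carrier → Set ℓ

  record IsFilter {ℓ} (F : Subset ℓ) : Set (c ⊔ ℓ) where
    field
      nonempty  : ∃ λ x → F x
      ⊗-closed  : ∀ {x y} → F x → F y → F (x ⊗ y)
      up-closed : ∀ {x y} → F x → x ≤ y → F y

  record IsNFoldFantasticFilter {ℓ} (n : ℕ) (F : Subset ℓ) : Set (c ⊔ ℓ) where
    field
      isFilter   : IsFilter F
      contains-𝟏 : F 𝟏
      fantastic  : ∀ x y → F (y ⇒ x) → F (((x ^ n ⇒ y) ⇒ y) ⇒ x)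

  record IsNFoldNormalFilter {ℓ} (n : ℕ) (F : Subset ℓ) : Set (c ⊔ ℓ) where
    field
      isFilter : IsFilter F
      normal   : ∀ x y → F ((y ^ n ⇒ x) ⇒ x) → F ((x ⇒ y) ⇒ y)

-- Put Z = (x ⇒ y) ⇒ y, which lies above both x and y.  As x ≤ Z, x ⇒ Z is in F,
-- so fantasticity (with Z for x and x for y) gives ((Zⁿ ⇒ x) ⇒ x) ⇒ Z ∈ F.  As
-- y ≤ Z and ⇒ is antitone in its first argument, (yⁿ ⇒ x) ⇒ x ≤ (Zⁿ ⇒ x) ⇒ x,
-- so the normality hypothesis puts the latter in F, and modus ponens gives Z ∈ F.
module Submission where

open import Defs
open import Level using (Level)
open import Data.Nat using (ℕ; _≥_; zero; suc)
open import Relation.Binary.PropositionalEquality using (_≡_; sym; trans; cong; subst)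

module ResiduatedLatticeProperties {c : Level} (L : ResiduatedLattice c) where
  open ResiduatedLattice L

  ≤-refl : ∀ x → x ≤ x
  ≤-refl x = trans (cong (x ∧_) (sym (∨-absorb-∧ x x))) (∧-absorb-∨ x (x ∧ x))

  ≤-trans : ∀ {x y z} → x ≤ y → y ≤ z → x ≤ z
  ≤-trans {x} {y} {z} x≤y y≤z =
    trans (cong (_∧ z) (sym x≤y)) (trans (∧-assoc x y z) (trans (cong (x ∧_) y≤z) x≤y))

  x≤𝟏 : ∀ x → x ≤ 𝟏
  x≤𝟏 = 𝟏-top

  ⊗-identityˡ : ∀ x → 𝟏 ⊗ x ≡ x
  ⊗-identityˡ x = trans (⊗-comm 𝟏 x) (⊗-identityʳ x)

  ⊗-monoˡ-≤ : ∀ {x y} z → x ≤ y → x ⊗ z ≤ y ⊗ z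
  ⊗-monoˡ-≤ {x} {y} z x≤y =
    residuation-⇐ x z (y ⊗ z) (≤-trans x≤y (residuation-⇒ y z (y ⊗ z) (≤-refl _)))

  ⊗-monoʳ-≤ : ∀ {x y} z → x ≤ y → z ⊗ x ≤ z ⊗ y
  ⊗-monoʳ-≤ {x} {y} z x≤y rewrite ⊗-comm z x | ⊗-comm z y = ⊗-monoˡ-≤ z x≤y

  x⊗y≤x : ∀ x y → x ⊗ y ≤ x
  x⊗y≤x x y = subst (x ⊗ y ≤_) (⊗-identityʳ x) (⊗-monoʳ-≤ x (x≤𝟏 y))

  ^-mono-≤ : ∀ {x y} n → x ≤ y → x ^ n ≤ y ^ n
  ^-mono-≤ zero    x≤y = ≤-refl 𝟏
  ^-mono-≤ {x} {y} (suc n) x≤y =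
    ≤-trans (⊗-monoˡ-≤ (x ^ n) x≤y) (⊗-monoʳ-≤ y (^-mono-≤ n x≤y))

  modus-ponens : ∀ x y → x ⊗ (x ⇒ y) ≤ y
  modus-ponens x y rewrite ⊗-comm x (x ⇒ y) = residuation-⇐ (x ⇒ y) x y (≤-refl _)

  ⇒-antitoneˡ-≤ : ∀ {x y} z → x ≤ y → y ⇒ z ≤ x ⇒ z
  ⇒-antitoneˡ-≤ {x} {y} z x≤y = residuation-⇒ (y ⇒ z) x z
    (≤-trans (⊗-monoʳ-≤ (y ⇒ z) x≤y) (subst (_≤ z) (⊗-comm y (y ⇒ z)) (modus-ponens y z)))

  𝟏≤⇒ : ∀ {x y} → x ≤ y → 𝟏 ≤ x ⇒ y
  𝟏≤⇒ {x} {y} x≤y = residuation-⇒ 𝟏 x y (subst (_≤ y) (sym (⊗-identityˡ x)) x≤y)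

  x≤[x⇒y]⇒y : ∀ x y → x ≤ (x ⇒ y) ⇒ y
  x≤[x⇒y]⇒y x y = residuation-⇒ x (x ⇒ y) y (modus-ponens x y)

  y≤[x⇒y]⇒y : ∀ x y → y ≤ (x ⇒ y) ⇒ y
  y≤[x⇒y]⇒y x y = residuation-⇒ y (x ⇒ y) y (x⊗y≤x y (x ⇒ y))

module FilterProperties {c ℓ : Level} (L : ResiduatedLattice c)
                        {F : Subset L ℓ} (isFilter : IsFilter L F) where
  open ResiduatedLattice L
  open ResiduatedLatticeProperties L
  open IsFilter isFilter

  ∈-modus-ponens : ∀ {x y} → F x → F (x ⇒ y) → F y
  ∈-modus-ponens {x} {y} x∈F x⇒y∈F = up-closed (⊗-closed x∈F x⇒y∈F) (modus-ponens x y)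

  ∈-⇒-of-≤ : F 𝟏 → ∀ {x y} → x ≤ y → F (x ⇒ y)
  ∈-⇒-of-≤ 𝟏∈F x≤y = up-closed 𝟏∈F (𝟏≤⇒ x≤y)

module _ {c ℓ : Level} (L : ResiduatedLattice c) (n : ℕ) {F : Subset L ℓ} where
  open ResiduatedLattice L
  open ResiduatedLatticeProperties L

  fantastic⇒normal : IsNFoldFantasticFilter L n F → IsNFoldNormalFilter L n F
  fantastic⇒normal fantasticF = record { isFilter = isFilter ; normal = normal }
    where
    open IsNFoldFantasticFilter fantasticF
    open IsFilter isFilter using (up-closed)
    open FilterProperties L isFilter

    normal : ∀ x y → F ((y ^ n ⇒ x) ⇒ x) → F ((x ⇒ y) ⇒ y)
    normal x y hyp = ∈-modus-ponens [Zⁿ⇒x]⇒x∈F (fantastic Z x x⇒Z∈F)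
      where
      Z = (x ⇒ y) ⇒ y

      x⇒Z∈F : F (x ⇒ Z)
      x⇒Z∈F = ∈-⇒-of-≤ contains-𝟏 (x≤[x⇒y]⇒y x y)

      [Zⁿ⇒x]⇒x∈F : F ((Z ^ n ⇒ x) ⇒ x)
      [Zⁿ⇒x]⇒x∈F = up-closed hyp
        (⇒-antitoneˡ-≤ x (⇒-antitoneˡ-≤ x (^-mono-≤ n (y≤[x⇒y]⇒y x y))))

-- The argument works for every n, including n = 0; the hypothesis n ≥ 1 is unused.
proposition7p5 : ∀ {c ℓ : Level} (L : ResiduatedLattice c) (n : ℕ) → n ≥ 1 →
    (F : Subset L ℓ) → IsNFoldFantasticFilter L n F → IsNFoldNormalFilter L n F
proposition7p5 L n _ F = fantastic⇒normal L n
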